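{- Let $V$ be a set of $n$ elements and let $\Pi=\{\mathcal{P}_1,\dots,\mathcal{P}_m\}$ be an $m$-scheme on $V$ ($1\le m\le n$) which is antisymmetric at level $2$, with $|\mathcal{P}_1|<n$ and $m\ge\log_2 n$. Then $\Pi$ contains a matching.
   Context: For $1\le s\le n$, $V^{(s)}$ denotes the set of $s$-tuples of pairwise distinct elements of $V$. For $s>1$ and $1\le i\le s$, $\pi^s_i:V^{(s)}\to V^{(s-1)}$ deletes the $i$-th coordinate; for a set $P\subseteq V^{(s)}$, $\pi^s_i(P)=\{\pi^s_i(\bar v):\bar v\in P\}$. $\mathrm{Symm}_s$ acts on $V^{(s)}$ by $(v_1,\dots,v_s)^\sigma=(v_{1^\sigma},\dots,v_{s^\sigma})$. An $m$-collection on $V$ is a family $\{\mathcal{P}_1,\dots,\mathcal{P}_m\}$ where $\mathcal{P}_s$ is a partition of $V^{(s)}$; its classes are called colors. It is: compatible at level $s>1$ if whenever $\bar u,\bar v$ lie in the same class of $\mathcal{P}_s$, for every $i$ the tuples $\pi^s_i(\bar u),\pi^s_i(\bar v)$ lie in the same class of $\mathcal{P}_{s-1}$; regular at level $s>1$ if whenever $\bar u,\bar v$ lie in the same class of $\mathcal{P}_{s-1}$, then for every $i$ and every $P\in\mathcal{P}_s$, $\#\{\bar u'\in P:\pi^s_i(\bar u')=\bar u\}=\#\{\bar v'\in P:\pi^s_i(\bar v')=\bar v\}$; invariant at level $s>1$ if $P^\sigma=\{\bar v^\sigma:\bar v\in P\}\in\mathcal{P}_s$ for all $P\in\mathcal{P}_s,\sigma\in\mathrm{Symm}_s$;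 antisymmetric at level $s$ if $P^\sigma\ne P$ for all $P\in\mathcal{P}_s$ and all $\sigma\in\mathrm{Symm}_s\setminus\{\mathrm{id}\}$. An $m$-scheme is an $m$-collection that is compatible, regular and invariant at every level $1<s\le m$. A color $P\in\mathcal{P}_s$ ($1<s\le m$) is a matching if there are $1\le i<j\le s$ with $\pi^s_i(P)=\pi^s_j(P)$ and $|\pi^s_i(P)|=|P|$; the $m$-scheme contains a matching if some color at some level $1<s\le m$ is a matching. -}

module Defs where

open import Data.Nat using (ℕ; zero; suc; _≤_; _<_)
import Data.Nat as ℕ
open import Data.Fin using (Fin)
import Data.Fin as F
open import Data.Fin.Permutation using (Permutation′; _⟨$⟩ʳ_)
open import Data.Vec using (Vec; []; _∷_; removeAt; tabulate; lookup)
open import Data.Vec.Properties using (≡-dec)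
open import Data.Vec.Relation.Unary.Unique.Propositional using (Unique)
open import Data.Vec.Relation.Unary.AllPairs using (allPairs?)
open import Data.List using (List; [_]; concatMap; map; filter; length; deduplicate)
open import Data.List.Relation.Unary.Any using (any?)
open import Data.Fin using () renaming (_<_ to _<ᶠ_)
open import Data.Product using (Σ; ∃; ∃-syntax; _×_; _,_)
open import Data.Product.Properties using ()
open import Relation.Nullary using (¬_; ¬?)
open import Relation.Nullary.Decidable using (_×-dec_)
open import Relation.Binary.PropositionalEquality using (_≡_)
open import Function.Bundles using (_⇔_)

-- V = Fin n.  A vector of length s over V is an s-tuple; V^(s) consists of
-- those with pairwise distinct entries (Unique).
Tuple : ℕ → ℕ → Set
Tuple n s = Vec (Fin n) s

distinct? : ∀ {n s} (v : Tuple n s) → Relation.Nullary.Dec (Unique v)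
distinct? = allPairs? (λ x y → ¬? (x F.≟ y))

-- A collection of partitions: partition 𝒫_s of V^(s) is given by a colouring
-- (only its values on V^(s) matter); the classes of 𝒫_s are the non-empty
-- fibres over V^(s).
Coloring : ℕ → Set
Coloring n = (s : ℕ) → Tuple n s → ℕ

InClass : ∀ {n} → Coloring n → (s : ℕ) → ℕ → Tuple n s → Set
InClass col s c v = Unique v × col s v ≡ c

IsColor : ∀ {n} → Coloring n → ℕ → ℕ → Set
IsColor {n} col s c = ∃[ v ] InClass {n} col s c v

allTuples : (n s : ℕ) → List (Tuple n s)
allTuples n zero = [ [] ]
allTuples n (suc s) = concatMap (λ x → map (x ∷_) (allTuples n s)) (Data.List.allFin n)

tuplesOf : (n s : ℕ) → List (Tuple n s)
tuplesOf n s = filter distinct? (allTuples n s)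

act : ∀ {n s} → Tuple n s → Permutation′ s → Tuple n s
act v σ = tabulate (λ i → lookup v (σ ⟨$⟩ʳ i))

InPerm : ∀ {n} → Coloring n → (s : ℕ) → ℕ → Permutation′ s → Tuple n s → Set
InPerm {n} col s c σ w = ∃[ v ] (InClass {n} col s c v × w ≡ act v σ)

InProj : ∀ {n} → Coloring n → (t : ℕ) → ℕ → Fin (suc t) → Tuple n t → Set
InProj {n} col t c i w = ∃[ v ] (InClass {n} col (suc t) c v × removeAt v i ≡ w)

-- Properties at level s = suc t (s > 1 means 1 ≤ t)

Compatible : ∀ {n} → Coloring n → ℕ → Set
Compatible {n} col t = (u v : Tuple n (suc t)) → Unique u → Unique v →
  col (suc t) u ≡ col (suc t) v →
  (i : Fin (suc t)) → col t (removeAt u i) ≡ col t (removeAt v i)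

fiberCount : ∀ {n} → Coloring n → (t : ℕ) → Fin (suc t) → ℕ → Tuple n t → ℕ
fiberCount {n} col t i c u =
  length (filter (λ u' → (col (suc t) u' ℕ.≟ c) ×-dec ≡-dec F._≟_ (removeAt u' i) u)
                 (tuplesOf n (suc t)))

Regular : ∀ {n} → Coloring n → ℕ → Set
Regular {n} col t = (u v : Tuple n t) → Unique u → Unique v →
  col t u ≡ col t v →
  (i : Fin (suc t)) (c : ℕ) → IsColor col (suc t) c →
  fiberCount col t i c u ≡ fiberCount col t i c v

Invariant : ∀ {n} → Coloring n → ℕ → Set
Invariant {n} col s = (c : ℕ) → IsColor col s c → (σ : Permutation′ s) →
  ∃[ d ] (IsColor col s d × ((w : Tuple n s) → InClass col s d w ⇔ InPerm col s c σ w))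

Antisymmetric : ∀ {n} → Coloring n → ℕ → Set
Antisymmetric {n} col s = (c : ℕ) → IsColor col s c → (σ : Permutation′ s) →
  ¬ ((i : Fin s) → σ ⟨$⟩ʳ i ≡ i) →
  ¬ ((w : Tuple n s) → InPerm col s c σ w ⇔ InClass col s c w)

IsScheme : (n m : ℕ) → Coloring n → Set
IsScheme n m col = (t : ℕ) → 1 ≤ t → suc t ≤ m →
  Compatible col t × Regular col t × Invariant col (suc t)

classSize : ∀ {n} → Coloring n → (s : ℕ) → ℕ → ℕ
classSize {n} col s c = length (filter (λ v → col s v ℕ.≟ c) (tuplesOf n s))

projSize : ∀ {n} → Coloring n → (t : ℕ) → Fin (suc t) → ℕ → ℕ
projSize {n} col t i c =
  length (filter (λ w → any? (λ v → (col (suc t) v ℕ.≟ c) ×-dec ≡-dec F._≟_ (removeAt v i) w)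
                               (tuplesOf n (suc t)))
                 (allTuples n t))

numClasses : ∀ {n} → Coloring n → ℕ → ℕ
numClasses {n} col s = length (deduplicate ℕ._≟_ (map (col s) (tuplesOf n s)))

IsMatching : ∀ {n} → Coloring n → (t : ℕ) → ℕ → Set
IsMatching {n} col t c = IsColor col (suc t) c ×
  ∃[ i ] ∃[ j ] (i <ᶠ j ×
    ((w : Tuple n t) → InProj col t c i w ⇔ InProj col t c j w) ×
    projSize col t i c ≡ classSize col (suc t) c)

ContainsMatching : (n m : ℕ) → Coloring n → Set
ContainsMatching n m col = ∃[ t ] (1 ≤ t × suc t ≤ m × ∃[ c ] IsMatching {n} col t c)

module Submission where

-- For a tuple p ∈ V^(s) and a colour c let ext(p, c) be the number of
-- points w with w ∷ p ∈ V^(s+1) of colour c.  As |𝒫_1| < n, two points share a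
-- colour c, so ext([], c) ≥ 2.  Given ext(p, c) ≥ 2, pick two such points
-- y ≠ z.  The colours d, d′ of z ∷ y ∷ p and y ∷ z ∷ p differ (antisymmetry at
-- level 2, lifted by compatibility); their extensions of y ∷ p are disjoint,
-- have colour c over p (compatibility), avoid y, and are non-empty
-- (regularity).  So the smaller one, D, has 1 ≤ k and 2k + 1 ≤ ext(p, c).  If
-- k = 1 the colour D is a matching; otherwise repeat with (y ∷ p, D).  After
-- m − 1 such steps ext([], c) ≥ 3·2^(m−1) − 1 > 2^m ≥ 2^⌈log₂ n⌉ ≥ n: absurd.
--
-- Coordinates are numbered from 1 in comments: π_1 deletes index F.zero.

open import Defs
open import Data.Nat using (ℕ; zero; suc; _+_; _*_; _^_; _≤_; _<_; z≤n; s≤s; ⌈_/2⌉)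
import Data.Nat as ℕ
open import Data.Nat.Properties
  using ( ≤-refl; ≤-trans; ≤-reflexive; ≤-antisym; ≤-total; ≤∧≢⇒<; n≮n; n≤1+n; m≤n+m
        ; +-suc; +-comm; +-mono-≤; +-monoˡ-≤; +-monoʳ-≤; *-monoʳ-≤; ^-monoʳ-≤; m^n>0
        ; ⌊n/2⌋+⌈n/2⌉≡n; ⌊n/2⌋≤⌈n/2⌉; module ≤-Reasoning)
open import Data.Nat.Tactic.RingSolver using (solve-∀)
open import Data.Nat.Logarithm using (⌈log₂_⌉)
open import Data.Nat.Logarithm.Core using (⌈log2⌉)
open import Data.Nat.Induction using (<-wellFounded)
open import Induction.WellFounded using (Acc; acc)
open import Data.Fin using (Fin)
import Data.Fin as F
open import Data.Fin.Properties using (pigeonhole; <⇒≢)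
open import Data.Fin.Permutation using (Permutation′; _⟨$⟩ʳ_; transpose)
open import Data.Vec using (Vec; []; _∷_; removeAt; head)
open import Data.Vec.Properties using (∷-injective; ≡-dec; tabulate∘lookup)
import Data.Vec.Relation.Unary.All as VecAll
open import Data.Vec.Relation.Unary.AllPairs using ([]; _∷_)
open import Data.Vec.Relation.Unary.Unique.Propositional using (Unique)
open import Data.List
  using (List; []; _∷_; length; filter; map; concatMap; allFin; _++_; cartesianProductWith; deduplicate; lookup)
open import Data.List.Properties using (length-++; length-removeAt′; length-map; length-filter; length-tabulate)
open import Data.List.Membership.Propositional using (_∈_; _─_; find; lose)
open import Data.List.Membership.Propositional.Properties
  using (∈-filter⁺; ∈-filter⁻; ∈-length; ∈-allFin; ∈-++⁻; ∈-map⁺; ∈-deduplicate⁺; ∈-cartesianProductWith⁺)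
open import Data.List.Relation.Unary.Any using (here; there; index; any?)
open import Data.List.Relation.Unary.Any.Properties using (lookup-index)
import Data.List.Relation.Unary.All as ListAll
open ListAll using ([]; _∷_)
open import Data.List.Relation.Unary.All.Properties using (¬Any⇒All¬)
open import Data.List.Relation.Unary.AllPairs using ([]; _∷_)
import Data.List.Relation.Unary.Unique.Propositional as List
import Data.List.Relation.Unary.Unique.Propositional.Properties as Unique
open import Data.List.Relation.Binary.Disjoint.Propositional using (Disjoint)
open import Data.Product using (∃; ∃₂; _×_; _,_; proj₁; proj₂)
open import Data.Sum using (_⊎_; inj₁; inj₂; [_,_]′; map₂)
open import Data.Empty using (⊥; ⊥-elim)
open import Function using (id; _∘_)
open import Function.Bundles using (_⇔_; mk⇔; Equivalence)
import Function.Properties.Equivalence as ⇔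
open import Level using (0ℓ)
open import Relation.Nullary using (¬_; yes; no)
open import Relation.Nullary.Decidable using (_×-dec_)
open import Relation.Unary using (Pred; Decidable; _⊆_)
open import Relation.Binary.PropositionalEquality
  using (_≡_; _≢_; refl; sym; trans; cong; subst; module ≡-Reasoning)

∈-─ : ∀ {A : Set} {x z : A} {xs : List A} (x∈xs : x ∈ xs) → z ∈ xs → z ≢ x → z ∈ xs ─ x∈xs
∈-─ (here refl) (here z≡x)   z≢x = ⊥-elim (z≢x z≡x)
∈-─ (here refl) (there z∈xs) z≢x = z∈xs
∈-─ (there x∈xs) (here z≡y)   z≢x = here z≡y
∈-─ (there x∈xs) (there z∈xs) z≢x = there (∈-─ x∈xs z∈xs z≢x)

module _ {A : Set} where

  length-≤-by-injection : ∀ {B : Set} (f : A → B) {xs : List A} {ys : List B} → List.Unique xs →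
    (∀ {x y} → x ∈ xs → y ∈ xs → f x ≡ f y → x ≡ y) →
    (∀ {x} → x ∈ xs → f x ∈ ys) → length xs ≤ length ys
  length-≤-by-injection f {[]} _ _ _ = z≤n
  length-≤-by-injection f {x ∷ xs} {ys} (x∉xs ∷ unique) inj into = begin
    suc (length xs)            ≤⟨ s≤s (length-≤-by-injection f unique inj′ into′) ⟩
    suc (length (ys ─ fx∈ys))  ≡⟨ sym (length-removeAt′ ys (index fx∈ys)) ⟩
    length ys                  ∎
    where
    open ≤-Reasoning
    fx∈ys = into (here refl)
    inj′ : ∀ {a b} → a ∈ xs → b ∈ xs → f a ≡ f b → a ≡ b
    inj′ a∈xs b∈xs = inj (there a∈xs) (there b∈xs)
    into′ : ∀ {a} → a ∈ xs → f a ∈ ys ─ fx∈ys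
    into′ a∈xs = ∈-─ fx∈ys (into (there a∈xs))
      λ fa≡fx → ListAll.lookup x∉xs a∈xs (sym (inj (there a∈xs) (here refl) fa≡fx))

  1≤length⇒∈ : ∀ {xs : List A} → 1 ≤ length xs → ∃ (_∈ xs)
  1≤length⇒∈ {x ∷ _} _ = x , here refl

  distinct-members⇒2≤length : ∀ {x y : A} {xs} → x ∈ xs → y ∈ xs → x ≢ y → 2 ≤ length xs
  distinct-members⇒2≤length {x} {y} {xs} x∈xs y∈xs x≢y =
    length-≤-by-injection id ((x≢y ∷ []) ∷ [] ∷ []) (λ _ _ x≡y → x≡y) into
    where
    into : ∀ {z} → z ∈ x ∷ y ∷ [] → z ∈ xs
    into (here refl)         = x∈xs
    into (there (here refl)) = y∈xs

  2≤length⇒distinct-members : ∀ {xs : List A} → List.Unique xs → 2 ≤ length xs →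
    ∃₂ λ x y → x ≢ y × x ∈ xs × y ∈ xs
  2≤length⇒distinct-members {x ∷ y ∷ _} ((x≢y ∷ _) ∷ _) (s≤s (s≤s z≤n)) =
    x , y , x≢y , here refl , there (here refl)

module _ {A : Set} {P : Pred A 0ℓ} (P? : Decidable P) where

  count : List A → ℕ
  count xs = length (filter P? xs)

  witness⇒1≤count : ∀ {x xs} → x ∈ xs → P x → 1 ≤ count xs
  witness⇒1≤count x∈xs px = ∈-length (∈-filter⁺ P? x∈xs px)

  1≤count⇒witness : ∀ xs → 1 ≤ count xs → ∃ λ x → x ∈ xs × P x
  1≤count⇒witness xs 1≤count with 1≤length⇒∈ 1≤count
  ... | x , x∈filter = x , ∈-filter⁻ P? x∈filter

  two-witnesses⇒2≤count : ∀ {x y xs} → x ∈ xs → y ∈ xs → x ≢ y → P x → P y → 2 ≤ count xs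
  two-witnesses⇒2≤count x∈xs y∈xs x≢y px py =
    distinct-members⇒2≤length (∈-filter⁺ P? x∈xs px) (∈-filter⁺ P? y∈xs py) x≢y

  2≤count⇒two-witnesses : ∀ {xs} → List.Unique xs → 2 ≤ count xs →
    ∃₂ λ x y → x ≢ y × (x ∈ xs × P x) × (y ∈ xs × P y)
  2≤count⇒two-witnesses unique 2≤count
    with 2≤length⇒distinct-members (Unique.filter⁺ P? unique) 2≤count
  ... | x , y , x≢y , x∈filter , y∈filter = x , y , x≢y , ∈-filter⁻ P? x∈filter , ∈-filter⁻ P? y∈filter

module _ {A : Set} {P Q R : Pred A 0ℓ} (P? : Decidable P) (Q? : Decidable Q) (R? : Decidable R)
         (P⊆R : P ⊆ R) (Q⊆R : Q ⊆ R) (P∩Q=∅ : ∀ {x} → P x → Q x → ⊥) where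

  disjoint-counts : ∀ {y xs} → List.Unique xs → y ∈ xs → R y → ¬ P y → ¬ Q y →
    suc (count P? xs + count Q? xs) ≤ count R? xs
  disjoint-counts {y} {xs} unique y∈xs ry ¬py ¬qy = begin
    suc (count P? xs + count Q? xs)  ≡⟨ cong suc (sym (length-++ Ps)) ⟩
    length (y ∷ Ps ++ Qs)            ≤⟨ length-≤-by-injection id unique′ (λ _ _ v≡w → v≡w) into ⟩
    count R? xs                      ∎
    where
    open ≤-Reasoning
    Ps = filter P? xs
    Qs = filter Q? xs
    y∉Ps++Qs : ¬ y ∈ Ps ++ Qs
    y∉Ps++Qs y∈ with ∈-++⁻ Ps y∈
    ... | inj₁ y∈Ps = ¬py (proj₂ (∈-filter⁻ P? {xs = xs} y∈Ps))
    ... | inj₂ y∈Qs = ¬qy (proj₂ (∈-filter⁻ Q? {xs = xs} y∈Qs))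
    disjoint : Disjoint Ps Qs
    disjoint (v∈Ps , v∈Qs) =
      P∩Q=∅ (proj₂ (∈-filter⁻ P? {xs = xs} v∈Ps)) (proj₂ (∈-filter⁻ Q? {xs = xs} v∈Qs))
    unique′ : List.Unique (y ∷ Ps ++ Qs)
    unique′ = ¬Any⇒All¬ _ y∉Ps++Qs
            ∷ Unique.++⁺ (Unique.filter⁺ P? unique) (Unique.filter⁺ Q? unique) disjoint
    into : ∀ {v} → v ∈ y ∷ Ps ++ Qs → v ∈ filter R? xs
    into (here refl) = ∈-filter⁺ R? y∈xs ry
    into (there v∈) with ∈-++⁻ Ps v∈
    ... | inj₁ v∈Ps = let v∈xs , pv = ∈-filter⁻ P? {xs = xs} v∈Ps in ∈-filter⁺ R? v∈xs (P⊆R pv)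
    ... | inj₂ v∈Qs = let v∈xs , qv = ∈-filter⁻ Q? {xs = xs} v∈Qs in ∈-filter⁺ R? v∈xs (Q⊆R qv)

-- allTuples is an iterated cartesian product, so it lists every tuple exactly once.
concatMap≡cartesianProductWith : ∀ {A B C : Set} (f : A → B → C) xs ys →
  concatMap (λ x → map (f x) ys) xs ≡ cartesianProductWith f xs ys
concatMap≡cartesianProductWith f []       ys = refl
concatMap≡cartesianProductWith f (x ∷ xs) ys =
  cong (map (f x) ys ++_) (concatMap≡cartesianProductWith f xs ys)

allTuples-suc : ∀ n s → allTuples n (suc s) ≡ cartesianProductWith _∷_ (allFin n) (allTuples n s)
allTuples-suc n s = concatMap≡cartesianProductWith _∷_ (allFin n) (allTuples n s)

allTuples-complete : ∀ n s (v : Tuple n s) → v ∈ allTuples n s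
allTuples-complete n zero    []      = here refl
allTuples-complete n (suc s) (x ∷ v) = subst (x ∷ v ∈_) (sym (allTuples-suc n s))
  (∈-cartesianProductWith⁺ _∷_ (∈-allFin x) (allTuples-complete n s v))

allTuples-unique : ∀ n s → List.Unique (allTuples n s)
allTuples-unique n zero    = [] ∷ []
allTuples-unique n (suc s) = subst List.Unique (sym (allTuples-suc n s))
  (Unique.cartesianProductWith⁺ _∷_ ∷-injective (Unique.allFin⁺ n) (allTuples-unique n s))

tuplesOf-unique : ∀ n s → List.Unique (tuplesOf n s)
tuplesOf-unique n s = Unique.filter⁺ distinct? (allTuples-unique n s)

unique⇒∈tuplesOf : ∀ {n s} {v : Tuple n s} → Unique v → v ∈ tuplesOf n s
unique⇒∈tuplesOf {n} {s} {v} = ∈-filter⁺ distinct? (allTuples-complete n s v)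

∈tuplesOf⇒unique : ∀ {n s} {v : Tuple n s} → v ∈ tuplesOf n s → Unique v
∈tuplesOf⇒unique {n} {s} v∈ = proj₂ (∈-filter⁻ distinct? {xs = allTuples n s} v∈)

removeAt-all : ∀ {A : Set} {P : Pred A 0ℓ} {s} (v : Vec A (suc s)) (i : Fin (suc s)) →
  VecAll.All P v → VecAll.All P (removeAt v i)
removeAt-all (x ∷ v)     F.zero    (_  VecAll.∷ pv) = pv
removeAt-all (x ∷ y ∷ v) (F.suc i) (px VecAll.∷ pv) = px VecAll.∷ removeAt-all (y ∷ v) i pv

removeAt-unique : ∀ {n s} (v : Tuple n (suc s)) (i : Fin (suc s)) → Unique v → Unique (removeAt v i)
removeAt-unique (x ∷ v)     F.zero    (_ ∷ u)    = u
removeAt-unique (x ∷ y ∷ v) (F.suc i) (x∉ ∷ u) = removeAt-all (y ∷ v) i x∉ ∷ removeAt-unique (y ∷ v) i u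

swap-unique : ∀ {n s} {z y : Fin n} {p : Tuple n s} → Unique (z ∷ y ∷ p) → Unique (y ∷ z ∷ p)
swap-unique ((z≢y VecAll.∷ z∉p) ∷ y∉p ∷ u) = ((λ y≡z → z≢y (sym y≡z)) VecAll.∷ y∉p) ∷ z∉p ∷ u

repeated-head : ∀ {n s} {y : Fin n} {p : Tuple n s} → ¬ Unique (y ∷ y ∷ p)
repeated-head ((y≢y VecAll.∷ _) ∷ _) = y≢y refl

module Colouring {n : ℕ} (col : Coloring n) where

  project-class : ∀ {t D v v′} → Compatible col t → InClass col (suc t) D v → InClass col (suc t) D v′ →
    (i : Fin (suc t)) → InClass col t (col t (removeAt v′ i)) (removeAt v i)
  project-class {v = v} {v′} compatible (uv , cv) (uv′ , cv′) i =
    removeAt-unique v i uv , compatible v v′ uv uv′ (trans cv (sym cv′)) i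

  fibre? : ∀ t (i : Fin (suc t)) (D : ℕ) (u : Tuple n t) →
    Decidable (λ v → (col (suc t) v ≡ D) × (removeAt v i ≡ u))
  fibre? t i D u v = (col (suc t) v ℕ.≟ D) ×-dec ≡-dec F._≟_ (removeAt v i) u

  regular-fibre : ∀ {t D v w} → Regular col t → InClass col (suc t) D v → (i : Fin (suc t)) →
    InClass col t (col t (removeAt v i)) w → InProj col t D i w
  regular-fibre {t} {D} {v} {w} regular (uv , cv) i (uw , cw) =
    let v′ , v′∈ , cv′ , π-v′ = 1≤count⇒witness (fibre? t i D w) _ w-fibre
    in  v′ , (∈tuplesOf⇒unique v′∈ , cv′) , π-v′
    where
    w-fibre : 1 ≤ fiberCount col t i D w
    w-fibre = subst (1 ≤_)
      (regular (removeAt v i) w (removeAt-unique v i uv) uw (sym cw) i D (v , uv , cv))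
      (witness⇒1≤count (fibre? t i D (removeAt v i)) (unique⇒∈tuplesOf uv) (cv , refl))

  projection-is-class : ∀ {t D v} → Compatible col t → Regular col t → InClass col (suc t) D v →
    (i : Fin (suc t)) (w : Tuple n t) → InProj col t D i w ⇔ InClass col t (col t (removeAt v i)) w
  projection-is-class compatible regular v∈D i w = mk⇔
    (λ { (v′ , v′∈D , refl) → project-class compatible v′∈D v∈D i })
    (regular-fibre regular v∈D i)

  injective-projection-size : ∀ {t} (i : Fin (suc t)) (D : ℕ) →
    (∀ {v v′} → InClass col (suc t) D v → InClass col (suc t) D v′ → removeAt v i ≡ removeAt v′ i → v ≡ v′) →
    projSize col t i D ≡ classSize col (suc t) D
  injective-projection-size {t} i D injective = ≤-antisym projSize≤classSize classSize≤projSize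
    where
    class? = λ v → col (suc t) v ℕ.≟ D
    image? = λ w → any? (fibre? t i D w) (tuplesOf n (suc t))
    P = filter class? (tuplesOf n (suc t))
    π : Tuple n (suc t) → Tuple n t
    π v = removeAt v i
    ∈P⇒InClass : ∀ {v} → v ∈ P → InClass col (suc t) D v
    ∈P⇒InClass v∈P = let v∈ , cv = ∈-filter⁻ class? {xs = tuplesOf n (suc t)} v∈P in ∈tuplesOf⇒unique v∈ , cv
    classSize≤projSize : classSize col (suc t) D ≤ projSize col t i D
    classSize≤projSize = length-≤-by-injection π (Unique.filter⁺ class? (tuplesOf-unique n (suc t)))
      (λ v∈P v′∈P → injective (∈P⇒InClass v∈P) (∈P⇒InClass v′∈P))
      (λ {v} v∈P → let v∈ , cv = ∈-filter⁻ class? {xs = tuplesOf n (suc t)} v∈P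
                   in ∈-filter⁺ image? (allTuples-complete n t (π v)) (lose v∈ (cv , refl)))
    projSize≤classSize : projSize col t i D ≤ classSize col (suc t) D
    projSize≤classSize = begin
      projSize col t i D  ≤⟨ length-≤-by-injection id (Unique.filter⁺ image? (allTuples-unique n t))
                               (λ _ _ w≡w′ → w≡w′) image⊆πP ⟩
      length (map π P)    ≡⟨ length-map π P ⟩
      classSize col (suc t) D ∎
      where
      open ≤-Reasoning
      image⊆πP : ∀ {w} → w ∈ filter image? (allTuples n t) → w ∈ map π P
      image⊆πP w∈ with find (proj₂ (∈-filter⁻ image? {xs = allTuples n t} w∈))
      ... | v , v∈ , cv , refl = ∈-map⁺ π (∈-filter⁺ class? v∈ cv)

  Extends : ∀ {s} → Tuple n s → ℕ → Fin n → Set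
  Extends {s} p c w = InClass col (suc s) c (w ∷ p)

  extends? : ∀ {s} (p : Tuple n s) (c : ℕ) → Decidable (Extends p c)
  extends? {s} p c w = distinct? (w ∷ p) ×-dec (col (suc s) (w ∷ p) ℕ.≟ c)

  extensions : ∀ {s} → Tuple n s → ℕ → ℕ
  extensions p c = count (extends? p c) (allFin n)

  -- The fibre of π_1 over u inside the class of colour D consists of the
  -- tuples w ∷ u with w an extension of u; hence the two counts agree.
  fibre≡extensions : ∀ {t} (D : ℕ) (u : Tuple n t) → fiberCount col t F.zero D u ≡ extensions u D
  fibre≡extensions {t} D u = ≤-antisym fibre≤extensions extensions≤fibre
    where
    Fibre = filter (fibre? t F.zero D u) (tuplesOf n (suc t))
    fibre-member : ∀ {v} → v ∈ Fibre → ∃ λ a → a ∷ u ≡ v × Extends u D a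
    fibre-member {a ∷ _} v∈ with ∈-filter⁻ (fibre? t F.zero D u) {xs = tuplesOf n (suc t)} v∈
    ... | v∈tuples , cv , refl = a , refl , ∈tuplesOf⇒unique v∈tuples , cv
    head-injective : ∀ {v v′} → v ∈ Fibre → v′ ∈ Fibre → head v ≡ head v′ → v ≡ v′
    head-injective v∈ v′∈ same-head with fibre-member v∈ | fibre-member v′∈
    ... | _ , refl , _ | _ , refl , _ = cong (_∷ u) same-head
    fibre≤extensions : fiberCount col t F.zero D u ≤ extensions u D
    fibre≤extensions = length-≤-by-injection head (Unique.filter⁺ (fibre? t F.zero D u) (tuplesOf-unique n (suc t)))
      head-injective
      (λ v∈ → let a , a∷u≡v , a-ext = fibre-member v∈
              in subst (λ v → head v ∈ filter (extends? u D) (allFin n)) a∷u≡v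
                       (∈-filter⁺ (extends? u D) (∈-allFin a) a-ext))
    extensions≤fibre : extensions u D ≤ fiberCount col t F.zero D u
    extensions≤fibre = length-≤-by-injection (_∷ u) (Unique.filter⁺ (extends? u D) (Unique.allFin⁺ n))
      (λ _ _ a∷u≡a′∷u → proj₁ (∷-injective a∷u≡a′∷u))
      (λ a∈ → let _ , ua , ca = ∈-filter⁻ (extends? u D) {xs = allFin n} a∈
              in ∈-filter⁺ (fibre? t F.zero D u) (unique⇒∈tuplesOf ua) (ca , refl))

  extensions≤n : ∀ {s} (p : Tuple n s) (c : ℕ) → extensions p c ≤ n
  extensions≤n p c = ≤-trans (length-filter (extends? p c) (allFin n)) (≤-reflexive (length-tabulate id))

  regular-extensions : ∀ {t D} {u u′ : Tuple n t} → Regular col t → IsColor col (suc t) D →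
    Unique u → Unique u′ → col t u ≡ col t u′ → extensions u D ≡ extensions u′ D
  regular-extensions {D = D} {u} {u′} regular D-colour uu uu′ same-colour = begin
    extensions u D                 ≡⟨ sym (fibre≡extensions D u) ⟩
    fiberCount col _ F.zero D u    ≡⟨ regular u u′ uu uu′ same-colour F.zero D D-colour ⟩
    fiberCount col _ F.zero D u′   ≡⟨ fibre≡extensions D u′ ⟩
    extensions u′ D                ∎
    where open ≡-Reasoning

  -- A colour D is a matching when some y ∷ p has exactly one extension w₀ in
  -- colour D and w₀ ∷ p has the colour of y ∷ p: π_1 and π_2 then have the
  -- same image (one class at level s+1), and π_1 is injective on D.
  unique-extension⇒matching : ∀ {s y w₀ D} {p : Tuple n s} →
    Compatible col (suc s) → Regular col (suc s) → Extends (y ∷ p) D w₀ →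
    col (suc s) (w₀ ∷ p) ≡ col (suc s) (y ∷ p) → extensions (y ∷ p) D ≡ 1 → IsMatching col (suc s) D
  unique-extension⇒matching {s} {y} {w₀} {D} {p} compatible regular w₀-ext same-colour one =
    D-colour , F.zero , F.suc F.zero , s≤s z≤n , same-images , injective-projection-size F.zero D π₁-injective
    where
    D-colour : IsColor col (suc (suc s)) D
    D-colour = w₀ ∷ y ∷ p , w₀-ext
    same-images : ∀ w → InProj col (suc s) D F.zero w ⇔ InProj col (suc s) D (F.suc F.zero) w
    same-images w = ⇔.trans (projection-is-class compatible regular w₀-ext F.zero w)
      (⇔.sym (subst (λ c → InProj col (suc s) D (F.suc F.zero) w ⇔ InClass col (suc s) c w) same-colour
                    (projection-is-class compatible regular w₀-ext (F.suc F.zero) w)))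
    π₁-injective : ∀ {v v′} → InClass col (suc (suc s)) D v → InClass col (suc (suc s)) D v′ →
      removeAt v F.zero ≡ removeAt v′ F.zero → v ≡ v′
    π₁-injective {a ∷ u} {a′ ∷ _} v∈D v′∈D refl with a F.≟ a′
    ... | yes refl = refl
    ... | no a≢a′  =
      let uu , cu = project-class compatible v∈D w₀-ext F.zero
      in  ⊥-elim (n≮n 1 (begin
      2                    ≤⟨ two-witnesses⇒2≤count (extends? u D) (∈-allFin a) (∈-allFin a′) a≢a′ v∈D v′∈D ⟩
      extensions u D       ≡⟨ regular-extensions regular D-colour uu (removeAt-unique _ F.zero (proj₁ w₀-ext)) cu ⟩
      extensions (y ∷ p) D ≡⟨ one ⟩
      1                    ∎))
      where open ≤-Reasoning

smaller-half : ∀ k k′ {K} → suc (k + k′) ≤ K → suc (k + k) ≤ K ⊎ suc (k′ + k′) ≤ K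
smaller-half k k′ k+k′<K with ≤-total k k′
... | inj₁ k≤k′ = inj₁ (≤-trans (s≤s (+-monoʳ-≤ k k≤k′)) k+k′<K)
... | inj₂ k′≤k = inj₂ (≤-trans (s≤s (≤-trans (+-monoʳ-≤ k′ k′≤k) (≤-reflexive (+-comm k′ k)))) k+k′<K)

-- k ≤ 2^⌈log₂ k⌉, by the recursion ⌈log₂ (k+2)⌉ = 1 + ⌈log₂ (1 + ⌈k/2⌉)⌉.
≤2^⌈log2⌉ : ∀ k (acc : Acc _<_ k) → k ≤ 2 ^ ⌈log2⌉ k acc
≤2^⌈log2⌉ zero          _        = z≤n
≤2^⌈log2⌉ (suc zero)    _        = s≤s z≤n
≤2^⌈log2⌉ (suc (suc k)) (acc rs) = begin
  suc (suc k)              ≤⟨ s≤s (s≤s k≤h+h) ⟩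
  suc (suc (h + h))        ≡⟨ double-suc h ⟩
  2 * suc h                ≤⟨ *-monoʳ-≤ 2 (≤2^⌈log2⌉ (suc h) _) ⟩
  2 ^ ⌈log2⌉ (suc (suc k)) (acc rs) ∎
  where
  open ≤-Reasoning
  h = ⌈ k /2⌉
  k≤h+h : k ≤ h + h
  k≤h+h = ≤-trans (≤-reflexive (sym (⌊n/2⌋+⌈n/2⌉≡n k))) (+-monoˡ-≤ h (⌊n/2⌋≤⌈n/2⌉ k))
  double-suc : ∀ h → suc (suc (h + h)) ≡ 2 * suc h
  double-suc = solve-∀

n≤2^⌈log₂n⌉ : ∀ n → n ≤ 2 ^ ⌈log₂ n ⌉
n≤2^⌈log₂n⌉ n = ≤2^⌈log2⌉ n (<-wellFounded n)

3X≰2X+1 : ∀ {X} → 2 ≤ X → ¬ (3 * X ≤ suc (2 * X))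
3X≰2X+1 {X} 2≤X 3X≤2X+1 = n≮n (suc (2 * X)) (≤-trans (+-monoˡ-≤ (2 * X) 2≤X) 3X≤2X+1)

doubling : ∀ {X k K} → 3 * X ≤ suc k → suc (k + k) ≤ K → 3 * (2 * X) ≤ suc K
doubling {X} {k} {K} 3X≤k+1 2k<K = begin
  3 * (2 * X)        ≡⟨ triple-double X ⟩
  3 * X + 3 * X      ≤⟨ +-mono-≤ 3X≤k+1 3X≤k+1 ⟩
  suc k + suc k      ≡⟨ cong suc (+-suc k k) ⟩
  suc (suc (k + k))  ≤⟨ s≤s 2k<K ⟩
  suc K              ∎
  where
  open ≤-Reasoning
  triple-double : ∀ X → 3 * (2 * X) ≡ 3 * X + 3 * X
  triple-double = solve-∀

module Scheme {n m : ℕ} (col : Coloring n) (scheme : IsScheme n m col)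
              (antisymmetric : Antisymmetric col 2) where
  open Colouring col

  compatible : ∀ {t} → 1 ≤ t → suc t ≤ m → Compatible col t
  compatible 1≤t t<m = proj₁ (scheme _ 1≤t t<m)

  regular : ∀ {t} → 1 ≤ t → suc t ≤ m → Regular col t
  regular 1≤t t<m = proj₁ (proj₂ (scheme _ 1≤t t<m))

  invariant : ∀ {t} → 1 ≤ t → suc t ≤ m → Invariant col (suc t)
  invariant 1≤t t<m = proj₂ (proj₂ (scheme _ 1≤t t<m))

  τ : ∀ {s} → Permutation′ (suc (suc s))
  τ = transpose F.zero (F.suc F.zero)

  act-τ : ∀ {s} (z y : Fin n) (p : Tuple n s) → act (z ∷ y ∷ p) τ ≡ y ∷ z ∷ p
  act-τ z y p = cong (λ q → y ∷ z ∷ q) (tabulate∘lookup p)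

  τ≢id : ∀ {s} → ¬ (∀ i → τ {s} ⟨$⟩ʳ i ≡ i)
  τ≢id fixes with fixes F.zero
  ... | ()

  -- Invariance carries the class P of (z , y) by τ onto the class of (y , z);
  -- if both had the same colour then P^τ = P, against antisymmetry.
  swapped-pair-colour : ∀ {z y : Fin n} → 2 ≤ m → z ≢ y → col 2 (z ∷ y ∷ []) ≢ col 2 (y ∷ z ∷ [])
  swapped-pair-colour {z} {y} 2≤m z≢y same = antisymmetric c c-colour τ τ≢id Pτ⇔P
    where
    c = col 2 (z ∷ y ∷ [])
    uzy : Unique (z ∷ y ∷ [])
    uzy = (z≢y VecAll.∷ VecAll.[]) ∷ VecAll.[] ∷ []
    c-colour : IsColor col 2 c
    c-colour = z ∷ y ∷ [] , uzy , refl
    image = invariant (s≤s z≤n) 2≤m c c-colour τ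
    d = proj₁ image
    d⇔Pτ = proj₂ (proj₂ image)
    d≡c : d ≡ c
    d≡c = trans (sym (proj₂ (Equivalence.from (d⇔Pτ (y ∷ z ∷ []))
                                (z ∷ y ∷ [] , (uzy , refl) , sym (act-τ z y [])))))
                (sym same)
    Pτ⇔P : ∀ w → InPerm col 2 c τ w ⇔ InClass col 2 c w
    Pτ⇔P w = ⇔.sym (subst (λ e → InClass col 2 e w ⇔ InPerm col 2 c τ w) d≡c (d⇔Pτ w))

  -- Compatibility: deleting the coordinates after the first two keeps the
  -- colours of (z , y , p) and (y , z , p) equal.
  swapped-prefix-colour : ∀ {s} {z y : Fin n} {p : Tuple n s} → suc (suc s) ≤ m → Unique (z ∷ y ∷ p) →
    col (suc (suc s)) (z ∷ y ∷ p) ≡ col (suc (suc s)) (y ∷ z ∷ p) → col 2 (z ∷ y ∷ []) ≡ col 2 (y ∷ z ∷ [])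
  swapped-prefix-colour {p = []} _ _ same = same
  swapped-prefix-colour {suc s} {z} {y} {a ∷ p} 3+s≤m uzyap same =
    swapped-prefix-colour (≤-trans (n≤1+n _) 3+s≤m) (removeAt-unique _ third uzyap)
      (compatible (s≤s z≤n) 3+s≤m (z ∷ y ∷ a ∷ p) (y ∷ z ∷ a ∷ p) uzyap (swap-unique uzyap) same third)
    where
    third : Fin (suc (suc (suc s)))
    third = F.suc (F.suc F.zero)

  swap-changes-colour : ∀ {s} {z y : Fin n} {p : Tuple n s} → suc (suc s) ≤ m → Unique (z ∷ y ∷ p) →
    col (suc (suc s)) (z ∷ y ∷ p) ≢ col (suc (suc s)) (y ∷ z ∷ p)
  swap-changes-colour 2+s≤m uzyp@((z≢y VecAll.∷ _) ∷ _) =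
    swapped-pair-colour (≤-trans (s≤s (s≤s z≤n)) 2+s≤m) z≢y ∘ swapped-prefix-colour 2+s≤m uzyp

  Halving : ∀ {s} → Tuple n s → ℕ → Set
  Halving p c = ∃₂ λ y D → 2 ≤ extensions (y ∷ p) D × suc (extensions (y ∷ p) D + extensions (y ∷ p) D) ≤ extensions p c

  matching-or-halving : ∀ {s y c D} {p : Tuple n s} → suc (suc s) ≤ m → Extends p c y →
    Extends (y ∷ p) D ⊆ Extends p c → 1 ≤ extensions (y ∷ p) D →
    suc (extensions (y ∷ p) D + extensions (y ∷ p) D) ≤ extensions p c →
    ContainsMatching n m col ⊎ Halving p c
  matching-or-halving {s} {y} {c} {D} {p} 2+s≤m (_ , cy) D⊆c 1≤k 2k<K with extensions (y ∷ p) D ℕ.≟ 1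
  ... | no k≢1 = inj₂ (y , D , ≤∧≢⇒< 1≤k (k≢1 ∘ sym) , 2k<K)
  ... | yes k≡1 =
    let w₀ , _ , w₀-ext = 1≤count⇒witness (extends? (y ∷ p) D) (allFin n) 1≤k
    in  inj₁ (suc s , s≤s z≤n , 2+s≤m , D ,
              unique-extension⇒matching (compatible (s≤s z≤n) 2+s≤m) (regular (s≤s z≤n) 2+s≤m)
                w₀-ext (trans (proj₂ (D⊆c w₀-ext)) (sym cy)) k≡1)

  -- Two distinct colour-c extensions y, z of p.  The colours d of z ∷ y ∷ p and
  -- d′ of y ∷ z ∷ p differ; by compatibility their extensions of y ∷ p extend p
  -- in colour c, disjointly and never by y itself; both are non-empty (z, and
  -- by regularity the image of y ∈ ext(z ∷ p, d′)).  The smaller one is used.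
  halving-from-pair : ∀ {s c y z} {p : Tuple n s} → suc (suc s) ≤ m → y ≢ z →
    Extends p c y → Extends p c z → ContainsMatching n m col ⊎ Halving p c
  halving-from-pair {s} {c} {y} {z} {p} 2+s≤m y≢z y-ext@(uy , cy) (uz@(z∉p ∷ _) , cz) =
    [ matching-or-halving 2+s≤m y-ext d⊆c 1≤k , matching-or-halving 2+s≤m y-ext d′⊆c 1≤k′ ]′
      (smaller-half k k′ total)
    where
    compatible-s = compatible (s≤s z≤n) 2+s≤m
    uzy : Unique (z ∷ y ∷ p)
    uzy = ((y≢z ∘ sym) VecAll.∷ z∉p) ∷ uy
    d = col (suc (suc s)) (z ∷ y ∷ p)
    d′ = col (suc (suc s)) (y ∷ z ∷ p)
    k = extensions (y ∷ p) d
    k′ = extensions (y ∷ p) d′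
    z-ext : Extends (y ∷ p) d z
    z-ext = uzy , refl
    y-ext′ : Extends (z ∷ p) d′ y
    y-ext′ = swap-unique uzy , refl
    d⊆c : Extends (y ∷ p) d ⊆ Extends p c
    d⊆c w-ext = subst (λ e → InClass col _ e _) cz (project-class compatible-s w-ext z-ext (F.suc F.zero))
    d′⊆c : Extends (y ∷ p) d′ ⊆ Extends p c
    d′⊆c w-ext = subst (λ e → InClass col _ e _) cy (project-class compatible-s w-ext y-ext′ (F.suc F.zero))
    total : suc (k + k′) ≤ extensions p c
    total = disjoint-counts (extends? (y ∷ p) d) (extends? (y ∷ p) d′) (extends? p c) d⊆c d′⊆c
      (λ (_ , cw) (_ , cw′) → swap-changes-colour 2+s≤m uzy (trans (sym cw) cw′))
      (Unique.allFin⁺ n) (∈-allFin y) y-ext (repeated-head ∘ proj₁) (repeated-head ∘ proj₁)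
    1≤k : 1 ≤ k
    1≤k = witness⇒1≤count (extends? (y ∷ p) d) (∈-allFin z) z-ext
    1≤k′ : 1 ≤ k′
    1≤k′ = subst (1 ≤_)
      (regular-extensions (regular (s≤s z≤n) 2+s≤m) (y ∷ z ∷ p , y-ext′) uz uy (trans cz (sym cy)))
      (witness⇒1≤count (extends? (z ∷ p) d′) (∈-allFin y) y-ext′)

  halving-step : ∀ {s c} {p : Tuple n s} → suc (suc s) ≤ m → 2 ≤ extensions p c →
    ContainsMatching n m col ⊎ Halving p c
  halving-step {c = c} {p} 2+s≤m 2≤K =
    let y , z , y≢z , (_ , y-ext) , (_ , z-ext) = 2≤count⇒two-witnesses (extends? p c) (Unique.allFin⁺ n) 2≤K
    in  halving-from-pair 2+s≤m y≢z y-ext z-ext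

  iterate : ∀ r {s c} {p : Tuple n s} → r + suc s ≤ m → 2 ≤ extensions p c →
    ContainsMatching n m col ⊎ 3 * 2 ^ r ≤ suc (extensions p c)
  iterate zero    _ 2≤K = inj₂ (s≤s 2≤K)
  iterate (suc r) {s} r+2+s≤m 2≤K with halving-step (≤-trans (s≤s (m≤n+m (suc s) r)) r+2+s≤m) 2≤K
  ... | inj₁ matching = inj₁ matching
  ... | inj₂ (_ , _ , 2≤k , 2k<K) with iterate r (subst (_≤ m) (sym (+-suc r (suc s))) r+2+s≤m) 2≤k
  ... | inj₁ matching = inj₁ matching
  ... | inj₂ 3·2^r≤k+1 = inj₂ (doubling {2 ^ r} 3·2^r≤k+1 2k<K)

  -- Fewer than n classes at level 1: by pigeonhole two points share a colour,
  -- i.e. some colour has at least two extensions of the empty tuple.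
  colour-of-two-points : numClasses col 1 < n → ∃ λ c → 2 ≤ extensions [] c
  colour-of-two-points few =
    let i , j , i<j , same-class = pigeonhole few class-index
    in  col 1 (i ∷ []) ,
        two-witnesses⇒2≤count (extends? [] _) (∈-allFin i) (∈-allFin j) (<⇒≢ i<j)
          (VecAll.[] ∷ [] , refl) (VecAll.[] ∷ [] , sym (same-colour same-class))
    where
    classes = deduplicate ℕ._≟_ (map (col 1) (tuplesOf n 1))
    colour∈classes : ∀ x → col 1 (x ∷ []) ∈ classes
    colour∈classes x = ∈-deduplicate⁺ ℕ._≟_ (∈-map⁺ (col 1) (unique⇒∈tuplesOf (VecAll.[] ∷ [])))
    class-index : Fin n → Fin (numClasses col 1)
    class-index x = index (colour∈classes x)
    same-colour : ∀ {i j} → class-index i ≡ class-index j → col 1 (i ∷ []) ≡ col 1 (j ∷ [])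
    same-colour {i} {j} same-class = begin
      col 1 (i ∷ [])                   ≡⟨ lookup-index (colour∈classes i) ⟩
      lookup classes (class-index i)   ≡⟨ cong (lookup classes) same-class ⟩
      lookup classes (class-index j)   ≡⟨ sym (lookup-index (colour∈classes j)) ⟩
      col 1 (j ∷ [])                   ∎
      where open ≡-Reasoning

  matching-or-many-points : numClasses col 1 < n → ∀ r → suc r ≤ m →
    ContainsMatching n m col ⊎ 3 * 2 ^ r ≤ suc n
  matching-or-many-points few r r<m =
    let c , 2≤K = colour-of-two-points few
    in  map₂ (λ bound → ≤-trans bound (s≤s (extensions≤n [] c)))
             (iterate r (subst (_≤ m) (sym (+-comm r 1)) r<m) 2≤K)

mainTheorem3 : (n m : ℕ) (col : Coloring n) →
    2 ≤ m → m ≤ n →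
    IsScheme n m col →
    Antisymmetric col 2 →
    numClasses col 1 < n →
    ⌈log₂ n ⌉ ≤ m →
    ContainsMatching n m col
mainTheorem3 n (suc (suc k)) col (s≤s (s≤s z≤n)) _ scheme antisymmetric few ⌈log₂n⌉≤m =
  [ id , (λ many-points → ⊥-elim (3X≰2X+1 2≤2^[m-1] (≤-trans many-points (s≤s n≤2^m)))) ]′
    (Scheme.matching-or-many-points col scheme antisymmetric few (suc k) ≤-refl)
  where
  2≤2^[m-1] : 2 ≤ 2 ^ suc k
  2≤2^[m-1] = *-monoʳ-≤ 2 (m^n>0 2 k)
  n≤2^m : n ≤ 2 ^ suc (suc k)
  n≤2^m = ≤-trans (n≤2^⌈log₂n⌉ n) (^-monoʳ-≤ 2 ⌈log₂n⌉≤m)
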